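{- Let $n\ge2$. For all $i\in\{1,\dots,n\}$ and all finite multisets $\Gamma,\Delta$ of $n$PC formulas, if $\Gamma\vdash_i\Delta$ is provable in $n$PC then $\Gamma\models_i\Delta$.
   Context: Fix $n\ge 2$, write $\hat n=\{1,\dots,n\}$, let $S_n$ be the group of permutations of $\hat n$ and $V$ a countable set of propositional variables. Formulas of $n$PC are: decorated variables $X^\pi$ ($X\in V$, $\pi\in S_n$); constants $\mathsf e_1,\dots,\mathsf e_n$; compound formulas $q(F,G_1,\dots,G_n)$ with $F,G_1,\dots,G_n$ formulas. For $\rho\in S_n$, $F^\rho$ is defined by $(X^\pi)^\rho=X^{\rho\circ\pi}$, $(\mathsf e_k)^\rho=\mathsf e_{\rho(k)}$, $q(F,G_1,\dots,G_n)^\rho=q(F,G_1^\rho,\dots,G_n^\rho)$ (the first argument is unchanged). $(ij)$ denotes the transposition exchanging $i$ and $j$ (the identity if $i=j$). Contexts $\Gamma,\Delta$ are finite multisets of formulas, $\Gamma^\rho$ is applied elementwise. A sequent is $\Gamma\vdash_i\Delta$ with $i\in\hat n$; it is provable if derivable with the following rules (premises $\Rightarrow$ conclusion), for all $i,j,k\in\hat n$: (Const) $\Rightarrow\ \vdash_i\mathsf e_i$. (Id) $\Rightarrow X^\pi\vdash_i X^\rho$ whenever $\pi^{ -1}(i)=\rho^{ -1}(i)$. (Sym) $\Gamma^{(ij)}\vdash_i\Delta^{(ij)}\Rightarrow\Gamma\vdash_j\Delta$. (Neg1) if $i\ne k$: $\Gamma^{(ij)}\vdash_i F,\Delta^{(ij)}\Rightarrow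 \Gamma,F^{(jk)}\vdash_j\Delta$. (Neg2) if $j\neq k$: $\Gamma^{(ij)}\vdash_i F,\Delta^{(ij)}\Rightarrow \Gamma,F^{(ik)}\vdash_j\Delta$. (Neg3) $\{\Gamma^{(ij)},F\vdash_i\Delta^{(ij)}\}_{i\neq j}\Rightarrow\Gamma\vdash_j F,\Delta$. (qL) $\{\Gamma^{(ji)},F,G_j^{(ji)}\vdash_j\Delta^{(ji)}\}_{j\in\hat n}\Rightarrow \Gamma,q(F,G_1,\dots,G_n)\vdash_i\Delta$. (qR) $\{\Gamma^{(ji)},F\vdash_j G_j^{(ji)},\Delta^{(ji)}\}_{j\in\hat n}\Rightarrow\Gamma\vdash_i q(F,G_1,\dots,G_n),\Delta$. (Cut) $\Gamma,F\vdash_i\Delta$ and $\Gamma\vdash_i F,\Delta\Rightarrow\Gamma\vdash_i\Delta$. Left and right weakening and contraction in each $\vdash_i$. Semantics: an environment is a function $v:V\to\hat n$; $[\![X^\pi]\!]_v=\pi(v(X))$, $[\![\mathsf e_i]\!]_v=i$, $[\![q(F,G_1,\dots,G_n)]\!]_v=[\![G_k]\!]_v$ where $k=[\![F]\!]_v$. $\Gamma\models_i\Delta$ means: for every environment $v$, if $[\![G]\!]_v=i$ for all $G\in\Gamma$ then $[\![F]\!]_v=i$ for some $F\in\Delta$. -}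

module Defs where

open import Data.Nat using (ℕ)
open import Data.Fin using (Fin)
open import Data.Fin.Permutation using (Permutation′; _⟨$⟩ʳ_; _⟨$⟩ˡ_; _∘ₚ_; transpose)
open import Data.List using (List; []; _∷_; map)
open import Data.List.Relation.Unary.All using (All)
open import Data.List.Relation.Unary.Any using (Any)
open import Data.List.Relation.Binary.Permutation.Propositional using (_↭_)
open import Relation.Binary.PropositionalEquality using (_≡_; _≢_)

-- Propositional variables: the countable set V is represented by ℕ.
-- The index set {1,…,n} is represented by Fin n (0-based).

module nPC (n : ℕ) where

  Perm : Set
  Perm = Permutation′ n

  data Formula : Set where
    var : ℕ → Perm → Formula
    e   : Fin n → Formula
    q   : Formula → (Fin n → Formula) → Formula

  -- composition in the usual mathematical order: (ρ ∘ π)(x) = ρ (π x)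
  _∘_ : Perm → Perm → Perm
  ρ ∘ π = π ∘ₚ ρ

  ⟨_⨟_⟩ : Fin n → Fin n → Perm
  ⟨ i ⨟ j ⟩ = transpose i j

  _^_ : Formula → Perm → Formula
  var X π ^ ρ = var X (ρ ∘ π)
  e k ^ ρ = e (ρ ⟨$⟩ʳ k)
  q F G ^ ρ = q F (λ k → G k ^ ρ)

  -- contexts (finite multisets, represented by lists up to permutation)
  Ctx : Set
  Ctx = List Formula

  _^*_ : Ctx → Perm → Ctx
  Γ ^* ρ = map (λ F → F ^ ρ) Γ

  data _⊢[_]_ : Ctx → Fin n → Ctx → Set where
    -- multiset structure of contexts
    exch : ∀ {Γ Γ′ Δ Δ′ i} → Γ ↭ Γ′ → Δ ↭ Δ′ → Γ ⊢[ i ] Δ → Γ′ ⊢[ i ] Δ′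
    const : ∀ {i} → [] ⊢[ i ] (e i ∷ [])
    idax : ∀ {X π ρ i} → π ⟨$⟩ˡ i ≡ ρ ⟨$⟩ˡ i → (var X π ∷ []) ⊢[ i ] (var X ρ ∷ [])
    sym : ∀ {Γ Δ i j} → (Γ ^* ⟨ i ⨟ j ⟩) ⊢[ i ] (Δ ^* ⟨ i ⨟ j ⟩) → Γ ⊢[ j ] Δ
    neg1 : ∀ {Γ Δ F i j k} → i ≢ k →
      (Γ ^* ⟨ i ⨟ j ⟩) ⊢[ i ] (F ∷ (Δ ^* ⟨ i ⨟ j ⟩)) →
      ((F ^ ⟨ j ⨟ k ⟩) ∷ Γ) ⊢[ j ] Δ
    neg2 : ∀ {Γ Δ F i j k} → j ≢ k →
      (Γ ^* ⟨ i ⨟ j ⟩) ⊢[ i ] (F ∷ (Δ ^* ⟨ i ⨟ j ⟩)) →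
      ((F ^ ⟨ i ⨟ k ⟩) ∷ Γ) ⊢[ j ] Δ
    neg3 : ∀ {Γ Δ F j} →
      ((i : Fin n) → i ≢ j → (F ∷ (Γ ^* ⟨ i ⨟ j ⟩)) ⊢[ i ] (Δ ^* ⟨ i ⨟ j ⟩)) →
      Γ ⊢[ j ] (F ∷ Δ)
    qL : ∀ {Γ Δ F G i} →
      ((j : Fin n) → (F ∷ (G j ^ ⟨ j ⨟ i ⟩) ∷ (Γ ^* ⟨ j ⨟ i ⟩)) ⊢[ j ] (Δ ^* ⟨ j ⨟ i ⟩)) →
      (q F G ∷ Γ) ⊢[ i ] Δ
    qR : ∀ {Γ Δ F G i} →
      ((j : Fin n) → (F ∷ (Γ ^* ⟨ j ⨟ i ⟩)) ⊢[ j ] ((G j ^ ⟨ j ⨟ i ⟩) ∷ (Δ ^* ⟨ j ⨟ i ⟩))) →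
      Γ ⊢[ i ] (q F G ∷ Δ)
    cut : ∀ {Γ Δ F i} → (F ∷ Γ) ⊢[ i ] Δ → Γ ⊢[ i ] (F ∷ Δ) → Γ ⊢[ i ] Δ
    weakL : ∀ {Γ Δ F i} → Γ ⊢[ i ] Δ → (F ∷ Γ) ⊢[ i ] Δ
    weakR : ∀ {Γ Δ F i} → Γ ⊢[ i ] Δ → Γ ⊢[ i ] (F ∷ Δ)
    contrL : ∀ {Γ Δ F i} → (F ∷ F ∷ Γ) ⊢[ i ] Δ → (F ∷ Γ) ⊢[ i ] Δ
    contrR : ∀ {Γ Δ F i} → Γ ⊢[ i ] (F ∷ F ∷ Δ) → Γ ⊢[ i ] (F ∷ Δ)

  Env : Set
  Env = ℕ → Fin n

  ⟦_⟧ : Formula → Env → Fin n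
  ⟦ var X π ⟧ v = π ⟨$⟩ʳ v X
  ⟦ e i ⟧ v = i
  ⟦ q F G ⟧ v = ⟦ G (⟦ F ⟧ v) ⟧ v

  _⊨[_]_ : Ctx → Fin n → Ctx → Set
  Γ ⊨[ i ] Δ = (v : Env) → All (λ G → ⟦ G ⟧ v ≡ i) Γ → Any (λ F → ⟦ F ⟧ v ≡ i) Δ

-- Each rule is sound at every single environment v. The key fact is that renaming
-- commutes with evaluation, ⟦ F ^ ρ ⟧ v = ρ (⟦ F ⟧ v): if every formula of Γ takes
-- the value j then every formula of Γ^(ij) takes the value i, and if some formula of
-- Δ^(ij) takes the value i then some formula of Δ takes the value j. This is exactly
-- how the rules pass between ⊢_j in the conclusion and ⊢_i in the premises.
module Submission where

open import Defs
open import Data.Nat using (ℕ; _≤_)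
open import Data.Fin using (Fin; _≟_)
open import Data.Fin.Permutation using (Permutation′; _⟨$⟩ʳ_; _⟨$⟩ˡ_)
import Data.Fin.Permutation.Components as PC
open import Data.List.Relation.Unary.All as All using (All; []; _∷_)
import Data.List.Relation.Unary.All.Properties as All
open import Data.List.Relation.Unary.Any as Any using (Any; here; there)
import Data.List.Relation.Unary.Any.Properties as Any
open import Data.List.Relation.Binary.Permutation.Propositional using (↭-sym)
open import Data.List.Relation.Binary.Permutation.Propositional.Properties
  using (All-resp-↭; Any-resp-↭)
open import Data.Empty using (⊥-elim)
open import Function.Bundles using (Inverse; Injection)
open import Function.Properties.Inverse using (↔⇒↣)
open import Relation.Nullary using (yes; no)
open import Relation.Nullary.Decidable using (dec-true)
open import Relation.Binary.PropositionalEquality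
  using (_≡_; refl; trans; cong; module ≡-Reasoning)
  renaming (sym to ≡-sym)

transpose-matchˡ : ∀ {m} (i j : Fin m) → PC.transpose i j i ≡ j
transpose-matchˡ i j rewrite dec-true (i ≟ i) refl = refl

transpose-matchʳ : ∀ {m} (i j : Fin m) → PC.transpose i j j ≡ i
transpose-matchʳ i j with j ≟ i
... | yes j≡i = j≡i
... | no _ rewrite dec-true (j ≟ j) refl = refl

⟨$⟩ʳ-injective : ∀ {m} (ρ : Permutation′ m) {x y : Fin m} → ρ ⟨$⟩ʳ x ≡ ρ ⟨$⟩ʳ y → x ≡ y
⟨$⟩ʳ-injective ρ = Injection.injective (↔⇒↣ ρ)

⟨$⟩ʳ-agree : ∀ {m} (π ρ : Permutation′ m) {x i : Fin m} → π ⟨$⟩ˡ i ≡ ρ ⟨$⟩ˡ i →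
             π ⟨$⟩ʳ x ≡ i → ρ ⟨$⟩ʳ x ≡ i
⟨$⟩ʳ-agree π ρ {x} {i} πˡi≡ρˡi πx≡i = Inverse.inverseˡ ρ (begin
  x         ≡⟨ ≡-sym (Inverse.inverseʳ π (≡-sym πx≡i)) ⟩
  π ⟨$⟩ˡ i  ≡⟨ πˡi≡ρˡi ⟩
  ρ ⟨$⟩ˡ i  ∎)
  where open ≡-Reasoning

module Soundness (n : ℕ) where
  open nPC n

  ⟦^⟧ : (F : Formula) (ρ : Perm) (v : Env) → ⟦ F ^ ρ ⟧ v ≡ ρ ⟨$⟩ʳ ⟦ F ⟧ v
  ⟦^⟧ (var X π) ρ v = refl
  ⟦^⟧ (e k)     ρ v = refl
  ⟦^⟧ (q F G)   ρ v = ⟦^⟧ (G (⟦ F ⟧ v)) ρ v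

  module _ (v : Env) where

    Takes : Fin n → Formula → Set
    Takes x F = ⟦ F ⟧ v ≡ x

    takes-^ : ∀ F (ρ : Perm) {x y} → ρ ⟨$⟩ʳ x ≡ y → Takes x F → Takes y (F ^ ρ)
    takes-^ F ρ ρx≡y F≡x = trans (⟦^⟧ F ρ v) (trans (cong (ρ ⟨$⟩ʳ_) F≡x) ρx≡y)

    takes-^⁻ : ∀ F (ρ : Perm) {x y} → ρ ⟨$⟩ʳ x ≡ y → Takes y (F ^ ρ) → Takes x F
    takes-^⁻ F ρ ρx≡y Fρ≡y =
      ⟨$⟩ʳ-injective ρ (trans (≡-sym (⟦^⟧ F ρ v)) (trans Fρ≡y (≡-sym ρx≡y)))

    all-^* : ∀ {Γ} (ρ : Perm) {x y} → ρ ⟨$⟩ʳ x ≡ y →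
             All (Takes x) Γ → All (Takes y) (Γ ^* ρ)
    all-^* ρ ρx≡y Γ≡x = All.map⁺ (All.map (λ {F} → takes-^ F ρ ρx≡y) Γ≡x)

    any-^*⁻ : ∀ {Δ} (ρ : Perm) {x y} → ρ ⟨$⟩ʳ x ≡ y →
              Any (Takes y) (Δ ^* ρ) → Any (Takes x) Δ
    any-^*⁻ ρ ρx≡y Δρ∋y = Any.map (λ {F} → takes-^⁻ F ρ ρx≡y) (Any.map⁻ Δρ∋y)

    all-swap : ∀ {Γ} i j → All (Takes j) Γ → All (Takes i) (Γ ^* ⟨ i ⨟ j ⟩)
    all-swap i j = all-^* ⟨ i ⨟ j ⟩ (transpose-matchʳ i j)

    any-swap⁻ : ∀ {Δ} i j → Any (Takes i) (Δ ^* ⟨ i ⨟ j ⟩) → Any (Takes j) Δ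
    any-swap⁻ i j = any-^*⁻ ⟨ i ⨟ j ⟩ (transpose-matchʳ i j)

  sound : ∀ {Γ i Δ} → Γ ⊢[ i ] Δ → Γ ⊨[ i ] Δ
  sound (exch Γ↭Γ′ Δ↭Δ′ d) v Γ≡i = Any-resp-↭ Δ↭Δ′ (sound d v (All-resp-↭ (↭-sym Γ↭Γ′) Γ≡i))
  sound const v [] = here refl
  sound (idax {π = π} {ρ} πˡi≡ρˡi) v (πX≡i ∷ []) = here (⟨$⟩ʳ-agree π ρ πˡi≡ρˡi πX≡i)
  sound (sym {i = i} {j} d) v Γ≡j = any-swap⁻ v i j (sound d v (all-swap v i j Γ≡j))
  sound (neg1 {F = F} {i} {j} {k} i≢k d) v (F≡j ∷ Γ≡j)
    with sound d v (all-swap v i j Γ≡j)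
  ... | here F≡i  =
    ⊥-elim (i≢k (trans (≡-sym F≡i) (takes-^⁻ v F ⟨ j ⨟ k ⟩ (transpose-matchʳ j k) F≡j)))
  ... | there Δ∋i = any-swap⁻ v i j Δ∋i
  sound (neg2 {F = F} {i} {j} {k} j≢k d) v (F≡j ∷ Γ≡j)
    with sound d v (all-swap v i j Γ≡j)
  ... | here F≡i  =
    ⊥-elim (j≢k (trans (≡-sym F≡j) (takes-^ v F ⟨ i ⨟ k ⟩ (transpose-matchˡ i k) F≡i)))
  ... | there Δ∋i = any-swap⁻ v i j Δ∋i
  sound (neg3 {F = F} {j} d) v Γ≡j with ⟦ F ⟧ v ≟ j
  ... | yes F≡j = here F≡j
  ... | no F≢j  = there (any-swap⁻ v x j (sound (d x F≢j) v (refl ∷ all-swap v x j Γ≡j)))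
    where x = ⟦ F ⟧ v
  sound (qL {F = F} {G} {i} d) v (Gx≡i ∷ Γ≡i) =
    any-swap⁻ v x i (sound (d x) v (refl ∷ Gx^≡x ∷ all-swap v x i Γ≡i))
    where
    x = ⟦ F ⟧ v
    Gx^≡x = takes-^ v (G x) ⟨ x ⨟ i ⟩ (transpose-matchʳ x i) Gx≡i
  sound (qR {F = F} {G} {i} d) v Γ≡i
    with sound (d (⟦ F ⟧ v)) v (refl ∷ all-swap v (⟦ F ⟧ v) i Γ≡i)
  ... | here Gx≡x =
    here (takes-^⁻ v (G (⟦ F ⟧ v)) ⟨ ⟦ F ⟧ v ⨟ i ⟩ (transpose-matchʳ (⟦ F ⟧ v) i) Gx≡x)
  ... | there Δ∋x = there (any-swap⁻ v (⟦ F ⟧ v) i Δ∋x)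
  sound (cut {F = F} {i} d₁ d₂) v Γ≡i with ⟦ F ⟧ v ≟ i
  ... | yes F≡i = sound d₁ v (F≡i ∷ Γ≡i)
  ... | no F≢i with sound d₂ v Γ≡i
  ...   | here F≡i  = ⊥-elim (F≢i F≡i)
  ...   | there Δ∋i = Δ∋i
  sound (weakL d) v (_ ∷ Γ≡i) = sound d v Γ≡i
  sound (weakR d) v Γ≡i = there (sound d v Γ≡i)
  sound (contrL d) v (F≡i ∷ Γ≡i) = sound d v (F≡i ∷ F≡i ∷ Γ≡i)
  sound (contrR d) v Γ≡i with sound d v Γ≡i
  ... | here F≡i  = here F≡i
  ... | there Δ∋i = Δ∋i

-- Soundness holds for every n.
proposition3p9 : (n : ℕ) → 2 ≤ n → (i : Fin n) → (Γ Δ : nPC.Ctx n) →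
    nPC._⊢[_]_ n Γ i Δ → nPC._⊨[_]_ n Γ i Δ
proposition3p9 n _ i Γ Δ = Soundness.sound n
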